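{- Let $\mathcal{L}=(\mathcal{B},\emptyset,\_)$ be a language with no constants, and let $\Gamma=\Gamma_s\,|\,\Gamma_t$ be a partitioned context. (A) For every $t$ with $\Gamma\vdash t\Leftarrow T$, there are a type $M$ and terms $l,r$ with $\Gamma_s\vdash l:M$ and $\Gamma_t.(x:M)\vdash r:T$ such that $\Gamma\vdash r[l..]\equiv t:T$ and, for all $p\in\{+,-\}$, $M^p\subseteq \Gamma_s^p\cap(\Gamma_t^{\bar p}\cup T^p)$. (B) For every $t$ with $\Gamma\vdash t\Rightarrow T$, either 1. $T^p\subseteq\Gamma_s^p$ for all $p$, and there are a type $M$ and terms $l,r$ with $\Gamma_t\vdash l:M$ and $\Gamma_s.(x:M)\vdash r:T$ such that $\Gamma\vdash r[l..]\equiv t:T$ and $M^p\subseteq \Gamma_s^{\bar p}\cap\Gamma_t^p$ for all $p$; or 2. $T^p\subseteq\Gamma_t^p$ for all $p$, and there are a type $M$ and terms $l,r$ with $\Gamma_s\vdash l:M$ and $\Gamma_t.(x:M)\vdash r:T$ such that $\Gamma\vdash r[l..]\equiv t:T$ and $M^p\subseteq\Gamma_s^p\cap\Gamma_t^{\bar p}$ for all $p$.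
   Context: Simply-typed $\lambda$-calculus with sums over a set $\mathcal{B}$ of base types. Types: $A,B::= b\ (b\in\mathcal{B})\mid \top\mid A\times B\mid A\to B\mid \bot\mid A+B$. Contexts are finite lists of typed variables. Terms: variables, $\star$, $(t,u)$, $\pi_1 t,\pi_2 t$, $\lambda x.t$, $t\,u$, $\mathrm{raise}\,t$, $\mathrm{inl}\,t$, $\mathrm{inr}\,t$, $\mathrm{case}\ s\ (x.b_l)\ (x.b_r)$, with the usual typing $\Gamma\vdash t:A$ ($\mathrm{raise}\,t:A$ for any $A$ if $t:\bot$; $\mathrm{case}\ s\ (x.b_l)\ (x.b_r):T$ if $s:A+B$, $\Gamma.(x:A)\vdash b_l:T$, $\Gamma.(x:B)\vdash b_r:T$). $r[l..]$ substitutes $l$ for the last context variable of $r$. Conversion $\Gamma\vdash t\equiv u:A$ is the least typed congruent equivalence relation containing the $\beta$- and $\eta$-laws of every type former (the equational theory of bicartesian closed categories). Normal forms $\Gamma\vdash t\Leftarrow A$ (checking) and neutral forms $\Gamma\vdash t\Rightarrow A$ (inferring) are defined mutually inductively: checking: $\star\Leftarrow\top$; $(t,u)\Leftarrow A\times B$ if $t\Leftarrow A$, $u\Leftarrow B$; $\lambda x.t\Leftarrow A\to B$ if $\Gamma.(x:A)\vdash t\Leftarrow B$; $\mathrm{inl}\,a\Leftarrow A+B$ if $a\Leftarrow A$; $\mathrm{inr}\,b\Leftarrow A+B$ if $b\Leftarrow B$; $t\Leftarrow A$ if $t\Rightarrow A$; $\mathrm{raise}\,t\Leftarrow A$ (any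 $A$) if $t\Rightarrow\bot$; $\mathrm{case}\ s\ (x.b_l)\ (x.b_r)\Leftarrow T$ if $s\Rightarrow A+B$, $\Gamma.(x:A)\vdash b_l\Leftarrow T$, $\Gamma.(x:B)\vdash b_r\Leftarrow T$. Inferring: $x\Rightarrow A$ if $(x:A)\in\Gamma$; $\pi_1 p\Rightarrow A$ and $\pi_2 p\Rightarrow B$ if $p\Rightarrow A\times B$; $t\,u\Rightarrow B$ if $t\Rightarrow A\to B$ and $u\Leftarrow A$. Polarised vocabulary: $b^+=\{b\}$, $b^-=\emptyset$; $\top^p=\bot^p=\emptyset$; $(A+B)^p=(A\times B)^p=A^p\cup B^p$; $(A\to B)^p=A^{\bar p}\cup B^p$, with $\bar+=-$, $\bar-=+$; for contexts $(\Gamma.(x:A))^p=\Gamma^p\cup A^p$, empty context empty. Context partition $\Gamma=\Gamma_1\,|\,\Gamma_2$: the empty context partitions as empty|empty, and if $\Gamma=\Gamma_1|\Gamma_2$ then $\Gamma.(x:A)=\Gamma_1.(x:A)\,|\,\Gamma_2$ and $\Gamma.(x:A)=\Gamma_1\,|\,\Gamma_2.(x:A)$; i.e. each variable of $\Gamma$ is assigned to exactly one of $\Gamma_1,\Gamma_2$, preserving order. Terms over $\Gamma_s$ or $\Gamma_t$ are viewed in $\Gamma$ via the induced renamings. -}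

module Defs where

open import Data.Empty using (⊥)
open import Data.Sum using (_⊎_)
open import Data.Product using (_×_)
open import Relation.Binary.PropositionalEquality using (_≡_)

data Ty (B : Set) : Set where
  base : B → Ty B
  `⊤   : Ty B
  _`×_ : Ty B → Ty B → Ty B
  _`→_ : Ty B → Ty B → Ty B
  `⊥   : Ty B
  _`+_ : Ty B → Ty B → Ty B

infixr 7 _`→_
infixr 8 _`+_
infixr 9 _`×_

data Ctx (B : Set) : Set where
  ε   : Ctx B
  _▷_ : Ctx B → Ty B → Ctx B

infixl 5 _▷_

data Pol : Set where
  + - : Pol

flip : Pol → Pol
flip + = -
flip - = +

module _ {B : Set} where

  occ : Pol → Ty B → B → Set
  occ + (base b') b = b ≡ b'
  occ - (base b') b = ⊥
  occ p `⊤ b = ⊥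
  occ p (A `× C) b = occ p A b ⊎ occ p C b
  occ p (A `→ C) b = occ (flip p) A b ⊎ occ p C b
  occ p `⊥ b = ⊥
  occ p (A `+ C) b = occ p A b ⊎ occ p C b

  occC : Pol → Ctx B → B → Set
  occC p ε b = ⊥
  occC p (Γ ▷ A) b = occC p Γ b ⊎ occ p A b

  data _∋_ : Ctx B → Ty B → Set where
    zero : ∀ {Γ A} → (Γ ▷ A) ∋ A
    suc  : ∀ {Γ A C} → Γ ∋ A → (Γ ▷ C) ∋ A

  infix 4 _∋_

  data Tm (Γ : Ctx B) : Ty B → Set where
    var   : ∀ {A} → Γ ∋ A → Tm Γ A
    star  : Tm Γ `⊤
    pair  : ∀ {A C} → Tm Γ A → Tm Γ C → Tm Γ (A `× C)
    π₁    : ∀ {A C} → Tm Γ (A `× C) → Tm Γ A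
    π₂    : ∀ {A C} → Tm Γ (A `× C) → Tm Γ C
    lam   : ∀ {A C} → Tm (Γ ▷ A) C → Tm Γ (A `→ C)
    app   : ∀ {A C} → Tm Γ (A `→ C) → Tm Γ A → Tm Γ C
    raise : ∀ {A} → Tm Γ `⊥ → Tm Γ A
    inl   : ∀ {A C} → Tm Γ A → Tm Γ (A `+ C)
    inr   : ∀ {A C} → Tm Γ C → Tm Γ (A `+ C)
    case  : ∀ {A C T} → Tm Γ (A `+ C) → Tm (Γ ▷ A) T → Tm (Γ ▷ C) T → Tm Γ T

  Ren : Ctx B → Ctx B → Set
  Ren Γ Δ = ∀ {A} → Γ ∋ A → Δ ∋ A

  liftR : ∀ {Γ Δ C} → Ren Γ Δ → Ren (Γ ▷ C) (Δ ▷ C)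
  liftR ρ zero = zero
  liftR ρ (suc x) = suc (ρ x)

  ren : ∀ {Γ Δ A} → Ren Γ Δ → Tm Γ A → Tm Δ A
  ren ρ (var x) = var (ρ x)
  ren ρ star = star
  ren ρ (pair t u) = pair (ren ρ t) (ren ρ u)
  ren ρ (π₁ t) = π₁ (ren ρ t)
  ren ρ (π₂ t) = π₂ (ren ρ t)
  ren ρ (lam t) = lam (ren (liftR ρ) t)
  ren ρ (app t u) = app (ren ρ t) (ren ρ u)
  ren ρ (raise t) = raise (ren ρ t)
  ren ρ (inl t) = inl (ren ρ t)
  ren ρ (inr t) = inr (ren ρ t)
  ren ρ (case s l r) = case (ren ρ s) (ren (liftR ρ) l) (ren (liftR ρ) r)

  wk : ∀ {Γ C A} → Tm Γ A → Tm (Γ ▷ C) A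
  wk = ren suc

  Sub : Ctx B → Ctx B → Set
  Sub Γ Δ = ∀ {A} → Γ ∋ A → Tm Δ A

  liftS : ∀ {Γ Δ C} → Sub Γ Δ → Sub (Γ ▷ C) (Δ ▷ C)
  liftS σ zero = var zero
  liftS σ (suc x) = wk (σ x)

  sub : ∀ {Γ Δ A} → Sub Γ Δ → Tm Γ A → Tm Δ A
  sub σ (var x) = σ x
  sub σ star = star
  sub σ (pair t u) = pair (sub σ t) (sub σ u)
  sub σ (π₁ t) = π₁ (sub σ t)
  sub σ (π₂ t) = π₂ (sub σ t)
  sub σ (lam t) = lam (sub (liftS σ) t)
  sub σ (app t u) = app (sub σ t) (sub σ u)
  sub σ (raise t) = raise (sub σ t)
  sub σ (inl t) = inl (sub σ t)
  sub σ (inr t) = inr (sub σ t)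
  sub σ (case s l r) = case (sub σ s) (sub (liftS σ) l) (sub (liftS σ) r)

  single : ∀ {Γ C} → Tm Γ C → Sub (Γ ▷ C) Γ
  single u zero = u
  single u (suc x) = var x

  _[_]₀ : ∀ {Γ C A} → Tm (Γ ▷ C) A → Tm Γ C → Tm Γ A
  r [ l ]₀ = sub (single l) r

  infix 4 _≈_

  data _≈_ {Γ : Ctx B} : ∀ {A} → Tm Γ A → Tm Γ A → Set where
    ≈refl  : ∀ {A} {t : Tm Γ A} → t ≈ t
    ≈sym   : ∀ {A} {t u : Tm Γ A} → t ≈ u → u ≈ t
    ≈trans : ∀ {A} {t u v : Tm Γ A} → t ≈ u → u ≈ v → t ≈ v
    pair-cong : ∀ {A C} {t t' : Tm Γ A} {u u' : Tm Γ C} → t ≈ t' → u ≈ u' → pair t u ≈ pair t' u'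
    π₁-cong : ∀ {A C} {t t' : Tm Γ (A `× C)} → t ≈ t' → π₁ t ≈ π₁ t'
    π₂-cong : ∀ {A C} {t t' : Tm Γ (A `× C)} → t ≈ t' → π₂ t ≈ π₂ t'
    lam-cong : ∀ {A C} {t t' : Tm (Γ ▷ A) C} → t ≈ t' → lam t ≈ lam t'
    app-cong : ∀ {A C} {t t' : Tm Γ (A `→ C)} {u u' : Tm Γ A} → t ≈ t' → u ≈ u' → app t u ≈ app t' u'
    raise-cong : ∀ {A} {t t' : Tm Γ `⊥} → t ≈ t' → raise {A = A} t ≈ raise t'
    inl-cong : ∀ {A C} {t t' : Tm Γ A} → t ≈ t' → inl {C = C} t ≈ inl t'
    inr-cong : ∀ {A C} {t t' : Tm Γ C} → t ≈ t' → inr {A = A} t ≈ inr t'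
    case-cong : ∀ {A C T} {s s' : Tm Γ (A `+ C)} {l l' : Tm (Γ ▷ A) T} {r r' : Tm (Γ ▷ C) T}
              → s ≈ s' → l ≈ l' → r ≈ r' → case s l r ≈ case s' l' r'
    ⊤-η : (t : Tm Γ `⊤) → t ≈ star
    ×-β₁ : ∀ {A C} (t : Tm Γ A) (u : Tm Γ C) → π₁ (pair t u) ≈ t
    ×-β₂ : ∀ {A C} (t : Tm Γ A) (u : Tm Γ C) → π₂ (pair t u) ≈ u
    ×-η  : ∀ {A C} (t : Tm Γ (A `× C)) → t ≈ pair (π₁ t) (π₂ t)
    →-β : ∀ {A C} (t : Tm (Γ ▷ A) C) (u : Tm Γ A) → app (lam t) u ≈ t [ u ]₀
    →-η : ∀ {A C} (t : Tm Γ (A `→ C)) → t ≈ lam (app (wk t) (var zero))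
    ⊥-η : ∀ {C} (e : Tm Γ `⊥) (u : Tm (Γ ▷ `⊥) C) → u [ e ]₀ ≈ raise e
    +-β₁ : ∀ {A C T} (a : Tm Γ A) (l : Tm (Γ ▷ A) T) (r : Tm (Γ ▷ C) T) → case (inl a) l r ≈ l [ a ]₀
    +-β₂ : ∀ {A C T} (c : Tm Γ C) (l : Tm (Γ ▷ A) T) (r : Tm (Γ ▷ C) T) → case (inr c) l r ≈ r [ c ]₀
    +-η  : ∀ {A C T} (s : Tm Γ (A `+ C)) (u : Tm (Γ ▷ (A `+ C)) T)
         → u [ s ]₀ ≈ case s (ren (liftR suc) u [ inl (var zero) ]₀)
                              (ren (liftR suc) u [ inr (var zero) ]₀)

  -- normal (checking) and neutral (inferring) forms
  mutual
    data Nf {Γ : Ctx B} : ∀ {A} → Tm Γ A → Set where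
      nf-star  : Nf star
      nf-pair  : ∀ {A C} {t : Tm Γ A} {u : Tm Γ C} → Nf t → Nf u → Nf (pair t u)
      nf-lam   : ∀ {A C} {t : Tm (Γ ▷ A) C} → Nf t → Nf (lam t)
      nf-inl   : ∀ {A C} {a : Tm Γ A} → Nf a → Nf (inl {C = C} a)
      nf-inr   : ∀ {A C} {c : Tm Γ C} → Nf c → Nf (inr {A = A} c)
      nf-ne    : ∀ {A} {t : Tm Γ A} → Ne t → Nf t
      nf-raise : ∀ {A} {t : Tm Γ `⊥} → Ne t → Nf (raise {A = A} t)
      nf-case  : ∀ {A C T} {s : Tm Γ (A `+ C)} {l : Tm (Γ ▷ A) T} {r : Tm (Γ ▷ C) T}
               → Ne s → Nf l → Nf r → Nf (case s l r)

    data Ne {Γ : Ctx B} : ∀ {A} → Tm Γ A → Set where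
      ne-var : ∀ {A} (x : Γ ∋ A) → Ne (var x)
      ne-π₁  : ∀ {A C} {p : Tm Γ (A `× C)} → Ne p → Ne (π₁ p)
      ne-π₂  : ∀ {A C} {p : Tm Γ (A `× C)} → Ne p → Ne (π₂ p)
      ne-app : ∀ {A C} {t : Tm Γ (A `→ C)} {u : Tm Γ A} → Ne t → Nf u → Ne (app t u)

  data Part : Ctx B → Ctx B → Ctx B → Set where
    ε|ε  : Part ε ε ε
    left  : ∀ {Γ Γs Γt A} → Part Γ Γs Γt → Part (Γ ▷ A) (Γs ▷ A) Γt
    right : ∀ {Γ Γs Γt A} → Part Γ Γs Γt → Part (Γ ▷ A) Γs (Γt ▷ A)

  embL : ∀ {Γ Γs Γt} → Part Γ Γs Γt → Ren Γs Γ
  embL (left P) zero = zero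
  embL (left P) (suc x) = suc (embL P x)
  embL (right P) x = suc (embL P x)

  embR : ∀ {Γ Γs Γt} → Part Γ Γs Γt → Ren Γt Γ
  embR (left P) x = suc (embR P x)
  embR (right P) zero = zero
  embR (right P) (suc x) = suc (embR P x)

  glue : ∀ {Γ Δl Δr M T} → Ren Δl Γ → Ren Δr Γ → Tm Δl M → Tm (Δr ▷ M) T → Tm Γ T
  glue ρl ρr l r = ren (liftR ρr) r [ ren ρl l ]₀

  _⊆_ : (B → Set) → (B → Set) → Set
  X ⊆ Y = ∀ b → X b → Y b

  _∩_ _∪_ : (B → Set) → (B → Set) → B → Set
  (X ∩ Y) b = X b × Y b
  (X ∪ Y) b = X b ⊎ Y b

-- A neutral term is a spine
-- headed by a variable, so its type only uses the vocabulary of that variable's side, and the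
-- rest of the spine is interpolated through a term from the other side. Interpolants of
-- subterms are combined with products (pairs, applications, and case splits whose scrutinee
-- lies on the Γt side); a case split on the Γs side is passed across as a function into a sum,
-- which is correct up to the commuting conversion for case. A neutral interpolant that points
-- the wrong way for a normal form is reversed by λ-abstraction, turning M into M → T.

module Submission where

open import Defs
open import Data.Product using (Σ; _×_; _,_)
import Data.Product as ×
open import Data.Sum using (_⊎_; inj₁; inj₂)
import Data.Sum as ⊎
open import Function using (id; _∘_)
open import Relation.Binary.PropositionalEquality using (_≡_; refl; sym; trans; cong; cong₂)

module _ {B : Set} where

  ⌜_⌝ : ∀ {Γ Δ : Ctx B} → Ren Γ Δ → Sub Γ Δ
  ⌜ ρ ⌝ x = var (ρ x)

  infixl 5 _,ₛ_

  _,ₛ_ : ∀ {Γ Δ : Ctx B} {A} → Sub Γ Δ → Tm Δ A → Sub (Γ ▷ A) Δ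
  (σ ,ₛ u) zero = u
  (σ ,ₛ u) (suc x) = σ x

  case-≡ : ∀ {Γ : Ctx B} {A C T} {s s' : Tm Γ (A `+ C)} {l l' : Tm (Γ ▷ A) T} {r r' : Tm (Γ ▷ C) T}
         → s ≡ s' → l ≡ l' → r ≡ r' → case s l r ≡ case s' l' r'
  case-≡ refl refl refl = refl

  -- Fusion lemmas take the composite as a pointwise hypothesis, avoiding function extensionality.

  liftR-as-liftS : ∀ {Γ Δ : Ctx B} {C} {ρ : Ren Γ Δ} {σ : Sub Γ Δ}
                 → (∀ {X} (x : Γ ∋ X) → var (ρ x) ≡ σ x)
                 → ∀ {X} (x : (Γ ▷ C) ∋ X) → var (liftR ρ x) ≡ liftS σ x
  liftR-as-liftS h zero = refl
  liftR-as-liftS h (suc x) = cong wk (h x)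

  ren-as-sub : ∀ {Γ Δ : Ctx B} {A} {ρ : Ren Γ Δ} {σ : Sub Γ Δ}
             → (∀ {X} (x : Γ ∋ X) → var (ρ x) ≡ σ x) → (t : Tm Γ A) → ren ρ t ≡ sub σ t
  ren-as-sub h (var x) = h x
  ren-as-sub h star = refl
  ren-as-sub h (pair t u) = cong₂ pair (ren-as-sub h t) (ren-as-sub h u)
  ren-as-sub h (π₁ t) = cong π₁ (ren-as-sub h t)
  ren-as-sub h (π₂ t) = cong π₂ (ren-as-sub h t)
  ren-as-sub h (lam t) = cong lam (ren-as-sub (liftR-as-liftS h) t)
  ren-as-sub h (app t u) = cong₂ app (ren-as-sub h t) (ren-as-sub h u)
  ren-as-sub h (raise t) = cong raise (ren-as-sub h t)
  ren-as-sub h (inl t) = cong inl (ren-as-sub h t)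
  ren-as-sub h (inr t) = cong inr (ren-as-sub h t)
  ren-as-sub h (case s l r) =
    case-≡ (ren-as-sub h s) (ren-as-sub (liftR-as-liftS h) l) (ren-as-sub (liftR-as-liftS h) r)

  liftS-liftR : ∀ {Γ Δ Θ : Ctx B} {C} {σ : Sub Δ Θ} {ρ : Ren Γ Δ} {σ' : Sub Γ Θ}
              → (∀ {X} (x : Γ ∋ X) → σ (ρ x) ≡ σ' x)
              → ∀ {X} (x : (Γ ▷ C) ∋ X) → liftS σ (liftR ρ x) ≡ liftS σ' x
  liftS-liftR h zero = refl
  liftS-liftR h (suc x) = cong wk (h x)

  sub-ren : ∀ {Γ Δ Θ : Ctx B} {A} {σ : Sub Δ Θ} {ρ : Ren Γ Δ} {σ' : Sub Γ Θ}
          → (∀ {X} (x : Γ ∋ X) → σ (ρ x) ≡ σ' x) → (t : Tm Γ A) → sub σ (ren ρ t) ≡ sub σ' t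
  sub-ren h (var x) = h x
  sub-ren h star = refl
  sub-ren h (pair t u) = cong₂ pair (sub-ren h t) (sub-ren h u)
  sub-ren h (π₁ t) = cong π₁ (sub-ren h t)
  sub-ren h (π₂ t) = cong π₂ (sub-ren h t)
  sub-ren h (lam t) = cong lam (sub-ren (liftS-liftR h) t)
  sub-ren h (app t u) = cong₂ app (sub-ren h t) (sub-ren h u)
  sub-ren h (raise t) = cong raise (sub-ren h t)
  sub-ren h (inl t) = cong inl (sub-ren h t)
  sub-ren h (inr t) = cong inr (sub-ren h t)
  sub-ren h (case s l r) =
    case-≡ (sub-ren h s) (sub-ren (liftS-liftR h) l) (sub-ren (liftS-liftR h) r)

  ren-ren : ∀ {Γ Δ Θ : Ctx B} {A} {ρ : Ren Δ Θ} {ρ' : Ren Γ Δ} {ρ'' : Ren Γ Θ}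
          → (∀ {X} (x : Γ ∋ X) → ρ (ρ' x) ≡ ρ'' x) → (t : Tm Γ A) → ren ρ (ren ρ' t) ≡ ren ρ'' t
  ren-ren h t = trans (ren-as-sub (λ _ → refl) (ren _ t))
                      (trans (sub-ren (λ x → cong var (h x)) t) (sym (ren-as-sub (λ _ → refl) t)))

  liftR-liftS : ∀ {Γ Δ Θ : Ctx B} {C} {ρ : Ren Δ Θ} {σ : Sub Γ Δ} {σ' : Sub Γ Θ}
              → (∀ {X} (x : Γ ∋ X) → ren ρ (σ x) ≡ σ' x)
              → ∀ {X} (x : (Γ ▷ C) ∋ X) → ren (liftR ρ) (liftS σ x) ≡ liftS σ' x
  liftR-liftS h zero = refl
  liftR-liftS {σ = σ} h (suc x) =
    trans (ren-ren (λ _ → refl) (σ x)) (trans (sym (ren-ren (λ _ → refl) (σ x))) (cong wk (h x)))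

  ren-sub : ∀ {Γ Δ Θ : Ctx B} {A} {ρ : Ren Δ Θ} {σ : Sub Γ Δ} {σ' : Sub Γ Θ}
          → (∀ {X} (x : Γ ∋ X) → ren ρ (σ x) ≡ σ' x) → (t : Tm Γ A) → ren ρ (sub σ t) ≡ sub σ' t
  ren-sub h (var x) = h x
  ren-sub h star = refl
  ren-sub h (pair t u) = cong₂ pair (ren-sub h t) (ren-sub h u)
  ren-sub h (π₁ t) = cong π₁ (ren-sub h t)
  ren-sub h (π₂ t) = cong π₂ (ren-sub h t)
  ren-sub h (lam t) = cong lam (ren-sub (liftR-liftS h) t)
  ren-sub h (app t u) = cong₂ app (ren-sub h t) (ren-sub h u)
  ren-sub h (raise t) = cong raise (ren-sub h t)
  ren-sub h (inl t) = cong inl (ren-sub h t)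
  ren-sub h (inr t) = cong inr (ren-sub h t)
  ren-sub h (case s l r) =
    case-≡ (ren-sub h s) (ren-sub (liftR-liftS h) l) (ren-sub (liftR-liftS h) r)

  liftS-liftS : ∀ {Γ Δ Θ : Ctx B} {C} {σ : Sub Δ Θ} {τ : Sub Γ Δ} {σ' : Sub Γ Θ}
              → (∀ {X} (x : Γ ∋ X) → sub σ (τ x) ≡ σ' x)
              → ∀ {X} (x : (Γ ▷ C) ∋ X) → sub (liftS σ) (liftS τ x) ≡ liftS σ' x
  liftS-liftS h zero = refl
  liftS-liftS {τ = τ} h (suc x) =
    trans (sub-ren (λ _ → refl) (τ x)) (trans (sym (ren-sub (λ _ → refl) (τ x))) (cong wk (h x)))

  sub-sub : ∀ {Γ Δ Θ : Ctx B} {A} {σ : Sub Δ Θ} {τ : Sub Γ Δ} {σ' : Sub Γ Θ}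
          → (∀ {X} (x : Γ ∋ X) → sub σ (τ x) ≡ σ' x) → (t : Tm Γ A) → sub σ (sub τ t) ≡ sub σ' t
  sub-sub h (var x) = h x
  sub-sub h star = refl
  sub-sub h (pair t u) = cong₂ pair (sub-sub h t) (sub-sub h u)
  sub-sub h (π₁ t) = cong π₁ (sub-sub h t)
  sub-sub h (π₂ t) = cong π₂ (sub-sub h t)
  sub-sub h (lam t) = cong lam (sub-sub (liftS-liftS h) t)
  sub-sub h (app t u) = cong₂ app (sub-sub h t) (sub-sub h u)
  sub-sub h (raise t) = cong raise (sub-sub h t)
  sub-sub h (inl t) = cong inl (sub-sub h t)
  sub-sub h (inr t) = cong inr (sub-sub h t)
  sub-sub h (case s l r) =
    case-≡ (sub-sub h s) (sub-sub (liftS-liftS h) l) (sub-sub (liftS-liftS h) r)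

  liftS-id : ∀ {Γ : Ctx B} {C} {σ : Sub Γ Γ}
           → (∀ {X} (x : Γ ∋ X) → σ x ≡ var x) → ∀ {X} (x : (Γ ▷ C) ∋ X) → liftS σ x ≡ var x
  liftS-id h zero = refl
  liftS-id h (suc x) = cong wk (h x)

  sub-id : ∀ {Γ : Ctx B} {A} {σ : Sub Γ Γ}
         → (∀ {X} (x : Γ ∋ X) → σ x ≡ var x) → (t : Tm Γ A) → sub σ t ≡ t
  sub-id h (var x) = h x
  sub-id h star = refl
  sub-id h (pair t u) = cong₂ pair (sub-id h t) (sub-id h u)
  sub-id h (π₁ t) = cong π₁ (sub-id h t)
  sub-id h (π₂ t) = cong π₂ (sub-id h t)
  sub-id h (lam t) = cong lam (sub-id (liftS-id h) t)
  sub-id h (app t u) = cong₂ app (sub-id h t) (sub-id h u)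
  sub-id h (raise t) = cong raise (sub-id h t)
  sub-id h (inl t) = cong inl (sub-id h t)
  sub-id h (inr t) = cong inr (sub-id h t)
  sub-id h (case s l r) =
    case-≡ (sub-id h s) (sub-id (liftS-id h) l) (sub-id (liftS-id h) r)

  sub-cong : ∀ {Γ Δ : Ctx B} {A} {σ σ' : Sub Γ Δ}
           → (∀ {X} (x : Γ ∋ X) → σ x ≡ σ' x) → (t : Tm Γ A) → sub σ t ≡ sub σ' t
  sub-cong h t = trans (cong (sub _) (sym (sub-id (λ _ → refl) t))) (sub-sub h t)

  ren-cong : ∀ {Γ Δ : Ctx B} {A} {ρ ρ' : Ren Γ Δ}
           → (∀ {X} (x : Γ ∋ X) → ρ x ≡ ρ' x) → (t : Tm Γ A) → ren ρ t ≡ ren ρ' t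
  ren-cong h t = trans (ren-as-sub (λ x → cong var (h x)) t) (sym (ren-as-sub (λ _ → refl) t))

  sub-wk-ren : ∀ {Γ Δ : Ctx B} {A C} {ρ : Ren Γ Δ} {u : Tm Δ C} (t : Tm Γ A)
             → sub (⌜ ρ ⌝ ,ₛ u) (wk t) ≡ ren ρ t
  sub-wk-ren t = trans (sub-ren (λ _ → refl) t) (sym (ren-as-sub (λ _ → refl) t))

  ≡⇒≈ : ∀ {Γ : Ctx B} {A} {t u : Tm Γ A} → t ≡ u → t ≈ u
  ≡⇒≈ refl = ≈refl

  -- By β-expansion this is a congruence of application, so ≈ need not be shown stable under substitution.
  sub-last-≈ : ∀ {Γ Δ : Ctx B} {M T} (σ : Sub Δ Γ) (r : Tm (Δ ▷ M) T) {u u' : Tm Γ M}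
             → u ≈ u' → sub (σ ,ₛ u) r ≈ sub (σ ,ₛ u') r
  sub-last-≈ {Δ = Δ} {M} σ r {u} {u'} u≈u' =
    ≈trans (≈sym (β-expand u)) (≈trans (app-cong ≈refl u≈u') (β-expand u'))
    where
    β-expand : ∀ v → app (lam (sub (liftS σ) r)) v ≈ sub (σ ,ₛ v) r
    β-expand v = ≈trans (→-β _ v) (≡⇒≈ (sub-sub single-liftS r))
      where
      single-liftS : ∀ {X} (x : (Δ ▷ M) ∋ X) → sub (single v) (liftS σ x) ≡ (σ ,ₛ v) x
      single-liftS zero = refl
      single-liftS (suc x) = trans (sub-ren (λ _ → refl) (σ x)) (sub-id (λ _ → refl) (σ x))

  sub-reindex : ∀ {Γ Δ Θ : Ctx B} {M T} {σ : Sub Δ Γ} {τ : Sub Θ Δ} {ρ : Ren Θ Γ}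
                (e : Tm Δ M) {u : Tm Γ M} (r : Tm (Θ ▷ M) T)
              → (∀ {X} (x : Θ ∋ X) → sub σ (τ x) ≡ var (ρ x)) → sub σ e ≈ u
              → sub σ (sub (τ ,ₛ e) r) ≈ sub (⌜ ρ ⌝ ,ₛ u) r
  sub-reindex {Θ = Θ} {M = M} {σ = σ} {τ} {ρ} e r h e≈u =
    ≈trans (≡⇒≈ (sub-sub extend r)) (sub-last-≈ ⌜ ρ ⌝ r e≈u)
    where
    extend : ∀ {X} (x : (Θ ▷ M) ∋ X) → sub σ ((τ ,ₛ e) x) ≡ (⌜ ρ ⌝ ,ₛ sub σ e) x
    extend zero = refl
    extend (suc x) = h x

  -- +-η abstracting the scrutinee s, then two β-steps in each branch.
  case-commute : ∀ {Γ : Ctx B} {A C M₁ M₂ T} (s : Tm Γ (A `+ C)) (a : Tm (Γ ▷ A) M₁) (c : Tm (Γ ▷ C) M₂)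
                 (R₁ : Tm (Γ ▷ M₁) T) (R₂ : Tm (Γ ▷ M₂) T)
               → case (case s (inl a) (inr c)) R₁ R₂
                 ≈ case s (sub (⌜ suc ⌝ ,ₛ a) R₁) (sub (⌜ suc ⌝ ,ₛ c) R₂)
  case-commute {Γ} {A} {C} {T = T} s a c R₁ R₂ =
    ≈trans (≡⇒≈ (sym u[s])) (≈trans (+-η s u) (case-cong ≈refl inl-branch inr-branch))
    where
    ↑ : ∀ {X Y} → Tm (Γ ▷ X) Y → Tm (Γ ▷ (A `+ C) ▷ X) Y
    ↑ = ren (liftR suc)

    u : Tm (Γ ▷ (A `+ C)) T
    u = case (case (var zero) (inl (↑ a)) (inr (↑ c))) (↑ R₁) (↑ R₂)

    ↑-cancel : ∀ {X Y} (t : Tm (Γ ▷ X) Y) → sub (liftS (single s)) (↑ t) ≡ t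
    ↑-cancel t = trans (sub-ren {σ' = var} (λ { zero → refl ; (suc x) → refl }) t) (sub-id (λ _ → refl) t)

    u[s] : u [ s ]₀ ≡ case (case s (inl a) (inr c)) R₁ R₂
    u[s] = case-≡ (case-≡ refl (cong inl (↑-cancel a)) (cong inr (↑-cancel c))) (↑-cancel R₁) (↑-cancel R₂)

    reduct : ∀ {D X Y} (j : Tm (Γ ▷ D) (A `+ C)) {v : Tm (Γ ▷ D) X} (t : Tm (Γ ▷ X) Y)
           → sub (single v) (sub (liftS (single j)) (ren (liftR (liftR suc)) (↑ t))) ≡ sub (⌜ suc ⌝ ,ₛ v) t
    reduct j t = trans (cong (sub _) (trans (sub-ren (λ _ → refl) (↑ t)) (sub-ren (λ _ → refl) t)))
                       (sub-sub (λ { zero → refl ; (suc x) → refl }) t)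

    reduct-id : ∀ {D Y} (j : Tm (Γ ▷ D) (A `+ C)) (t : Tm (Γ ▷ D) Y)
              → sub (single (var zero)) (sub (liftS (single j)) (ren (liftR (liftR suc)) (↑ t))) ≡ t
    reduct-id j t = trans (reduct j t) (sub-id (λ { zero → refl ; (suc x) → refl }) t)

    inl-branch : ren (liftR suc) u [ inl (var zero) ]₀ ≈ sub (⌜ suc ⌝ ,ₛ a) R₁
    inl-branch = ≈trans (case-cong (+-β₁ _ _ _) ≈refl ≈refl) (≈trans (+-β₁ _ _ _)
      (≡⇒≈ (trans (reduct _ R₁) (cong (λ a' → sub (⌜ suc ⌝ ,ₛ a') R₁) (reduct-id _ a)))))

    inr-branch : ren (liftR suc) u [ inr (var zero) ]₀ ≈ sub (⌜ suc ⌝ ,ₛ c) R₂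
    inr-branch = ≈trans (case-cong (+-β₂ _ _ _) ≈refl ≈refl) (≈trans (+-β₂ _ _ _)
      (≡⇒≈ (trans (reduct _ R₂) (cong (λ c' → sub (⌜ suc ⌝ ,ₛ c') R₂) (reduct-id _ c)))))

  embL-or-embR : ∀ {Γ Γs Γt : Ctx B} {A} (P : Part Γ Γs Γt) (x : Γ ∋ A)
               → (Σ (Γs ∋ A) λ y → embL P y ≡ x) ⊎ (Σ (Γt ∋ A) λ y → embR P y ≡ x)
  embL-or-embR (left P) zero = inj₁ (zero , refl)
  embL-or-embR (right P) zero = inj₂ (zero , refl)
  embL-or-embR (left P) (suc x) with embL-or-embR P x
  ... | inj₁ (y , eq) = inj₁ (suc y , cong suc eq)
  ... | inj₂ (y , eq) = inj₂ (y , cong suc eq)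
  embL-or-embR (right P) (suc x) with embL-or-embR P x
  ... | inj₁ (y , eq) = inj₁ (y , cong suc eq)
  ... | inj₂ (y , eq) = inj₂ (suc y , cong suc eq)

  swap : ∀ {Γ Γs Γt : Ctx B} → Part Γ Γs Γt → Part Γ Γt Γs
  swap ε|ε = ε|ε
  swap (left P) = right (swap P)
  swap (right P) = left (swap P)

  embL-swap : ∀ {Γ Γs Γt : Ctx B} (P : Part Γ Γs Γt) {A} (x : Γt ∋ A) → embL (swap P) x ≡ embR P x
  embL-swap (left P) x = cong suc (embL-swap P x)
  embL-swap (right P) zero = refl
  embL-swap (right P) (suc x) = cong suc (embL-swap P x)

  embR-swap : ∀ {Γ Γs Γt : Ctx B} (P : Part Γ Γs Γt) {A} (x : Γs ∋ A) → embR (swap P) x ≡ embL P x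
  embR-swap (left P) zero = refl
  embR-swap (left P) (suc x) = cong suc (embR-swap P x)
  embR-swap (right P) x = cong suc (embR-swap P x)

  glue-as-sub : ∀ {Γ Δl Δr : Ctx B} {M T} {ρl : Ren Δl Γ} {ρr : Ren Δr Γ} (l : Tm Δl M) (r : Tm (Δr ▷ M) T)
              → glue ρl ρr l r ≡ sub (⌜ ρr ⌝ ,ₛ ren ρl l) r
  glue-as-sub l r = sub-ren (λ { zero → refl ; (suc x) → refl }) r

  glue-cong : ∀ {Γ Δl Δr : Ctx B} {M T} {ρl ρl' : Ren Δl Γ} {ρr ρr' : Ren Δr Γ}
            → (∀ {X} (x : Δl ∋ X) → ρl x ≡ ρl' x) → (∀ {X} (x : Δr ∋ X) → ρr x ≡ ρr' x)
            → (l : Tm Δl M) (r : Tm (Δr ▷ M) T) → glue ρl ρr l r ≡ glue ρl' ρr' l r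
  glue-cong hl hr l r =
    trans (glue-as-sub l r)
      (trans (sub-cong (λ { zero → ren-cong hl l ; (suc x) → cong var (hr x) }) r) (sym (glue-as-sub l r)))

  glue-swap : ∀ {Γ Γs Γt : Ctx B} (P : Part Γ Γs Γt) {M T} (l : Tm Γt M) (r : Tm (Γs ▷ M) T)
            → glue (embL (swap P)) (embR (swap P)) l r ≡ glue (embR P) (embL P) l r
  glue-swap P = glue-cong (embL-swap P) (embR-swap P)

  _∘π₁ : ∀ {Γ : Ctx B} {A C T} → Tm (Γ ▷ A) T → Tm (Γ ▷ A `× C) T
  r ∘π₁ = sub (⌜ suc ⌝ ,ₛ π₁ (var zero)) r

  _∘π₂ : ∀ {Γ : Ctx B} {A C T} → Tm (Γ ▷ C) T → Tm (Γ ▷ A `× C) T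
  r ∘π₂ = sub (⌜ suc ⌝ ,ₛ π₂ (var zero)) r

  ∘π₁-glue : ∀ {Γ Δl Δr : Ctx B} {M₁ M₂ T} {ρl : Ren Δl Γ} {ρr : Ren Δr Γ}
             (l₁ : Tm Δl M₁) (l₂ : Tm Δl M₂) (r : Tm (Δr ▷ M₁) T)
           → sub (⌜ ρr ⌝ ,ₛ ren ρl (pair l₁ l₂)) (r ∘π₁) ≈ glue ρl ρr l₁ r
  ∘π₁-glue l₁ l₂ r = ≈trans (sub-reindex _ r (λ _ → refl) (×-β₁ _ _)) (≡⇒≈ (sym (glue-as-sub l₁ r)))

  ∘π₂-glue : ∀ {Γ Δl Δr : Ctx B} {M₁ M₂ T} {ρl : Ren Δl Γ} {ρr : Ren Δr Γ}
             (l₁ : Tm Δl M₁) (l₂ : Tm Δl M₂) (r : Tm (Δr ▷ M₂) T)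
           → sub (⌜ ρr ⌝ ,ₛ ren ρl (pair l₁ l₂)) (r ∘π₂) ≈ glue ρl ρr l₂ r
  ∘π₂-glue l₁ l₂ r = ≈trans (sub-reindex _ r (λ _ → refl) (×-β₂ _ _)) (≡⇒≈ (sym (glue-as-sub l₂ r)))

  glue-pair : ∀ {Γ Δl Δr : Ctx B} {M₁ M₂ A C} {ρl : Ren Δl Γ} {ρr : Ren Δr Γ}
              (l₁ : Tm Δl M₁) (l₂ : Tm Δl M₂) (r₁ : Tm (Δr ▷ M₁) A) (r₂ : Tm (Δr ▷ M₂) C)
              {t : Tm Γ A} {u : Tm Γ C}
            → glue ρl ρr l₁ r₁ ≈ t → glue ρl ρr l₂ r₂ ≈ u
            → glue ρl ρr (pair l₁ l₂) (pair (r₁ ∘π₁) (r₂ ∘π₂)) ≈ pair t u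
  glue-pair l₁ l₂ r₁ r₂ e₁ e₂ =
    ≈trans (≡⇒≈ (glue-as-sub (pair l₁ l₂) (pair (r₁ ∘π₁) (r₂ ∘π₂))))
           (pair-cong (≈trans (∘π₁-glue l₁ l₂ r₁) e₁) (≈trans (∘π₂-glue l₁ l₂ r₂) e₂))

  glue-app : ∀ {Γ Δl Δr : Ctx B} {M₁ M₂ A C} {ρl : Ren Δl Γ} {ρr : Ren Δr Γ}
             (l₁ : Tm Δl M₁) (l₂ : Tm Δl M₂) (r₁ : Tm (Δr ▷ M₁) (A `→ C)) (r₂ : Tm (Δr ▷ M₂) A)
             {t : Tm Γ (A `→ C)} {u : Tm Γ A}
           → glue ρl ρr l₁ r₁ ≈ t → glue ρl ρr l₂ r₂ ≈ u
           → glue ρl ρr (pair l₁ l₂) (app (r₁ ∘π₁) (r₂ ∘π₂)) ≈ app t u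
  glue-app l₁ l₂ r₁ r₂ e₁ e₂ =
    ≈trans (≡⇒≈ (glue-as-sub (pair l₁ l₂) (app (r₁ ∘π₁) (r₂ ∘π₂))))
           (app-cong (≈trans (∘π₁-glue l₁ l₂ r₁) e₁) (≈trans (∘π₂-glue l₁ l₂ r₂) e₂))

  glue-transpose : ∀ {Γ Δl Δr : Ctx B} {M T} {ρl : Ren Δl Γ} {ρr : Ren Δr Γ} (l : Tm Δl M) (r : Tm (Δr ▷ M) T)
                 → glue ρr ρl (lam r) (app (var zero) (wk l)) ≈ glue ρl ρr l r
  glue-transpose {ρl = ρl} {ρr} l r =
    ≈trans (≡⇒≈ (trans (glue-as-sub {ρl = ρr} {ρl} (lam r) (app (var zero) (wk l)))
                       (cong (app _) (sub-wk-ren l))))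
           (→-β _ _)

  -- Bodies of λ and of Γt-side case branches, whose bound variable joins the Γt side.
  glue-under-right : ∀ {Γ Γs Γt : Ctx B} (P : Part Γ Γs Γt) {A M M' T}
                     (l : Tm Γs M) (l' : Tm Γs M') (e : Tm (Γt ▷ M ▷ A) M') (r : Tm (Γt ▷ A ▷ M') T)
                   → sub (liftS (⌜ embR P ⌝ ,ₛ ren (embL P) l)) e ≈ wk (ren (embL P) l')
                   → sub (liftS (⌜ embR P ⌝ ,ₛ ren (embL P) l)) (sub (⌜ liftR suc ⌝ ,ₛ e) r)
                     ≈ glue (embL (right P)) (embR (right P)) l' r
  glue-under-right P l l' e r e≈l' =
    ≈trans (sub-reindex e r (λ { zero → refl ; (suc x) → refl }) (≈trans e≈l' (≡⇒≈ (ren-ren (λ _ → refl) l'))))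
           (≡⇒≈ (sym (glue-as-sub l' r)))

  glue-lam : ∀ {Γ Γs Γt : Ctx B} (P : Part Γ Γs Γt) {A M C} (l : Tm Γs M) (r : Tm (Γt ▷ A ▷ M) C)
           → glue (embL P) (embR P) l (lam (sub (⌜ liftR suc ⌝ ,ₛ var (suc zero)) r))
             ≈ lam (glue (embL (right P)) (embR (right P)) l r)
  glue-lam P l r =
    ≈trans (≡⇒≈ (glue-as-sub l (lam (sub (⌜ liftR suc ⌝ ,ₛ var (suc zero)) r))))
           (lam-cong (glue-under-right P l l (var (suc zero)) r ≈refl))

  glue-case-right : ∀ {Γ Γs Γt : Ctx B} (P : Part Γ Γs Γt) {A C Ms M₁ M₂ T}
                    (ls : Tm Γs Ms) (rs : Tm (Γt ▷ Ms) (A `+ C))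
                    (l₁ : Tm Γs M₁) (l₂ : Tm Γs M₂) (r₁ : Tm (Γt ▷ A ▷ M₁) T) (r₂ : Tm (Γt ▷ C ▷ M₂) T)
                  → glue (embL P) (embR P) (pair ls (pair l₁ l₂))
                      (case (rs ∘π₁) (sub (⌜ liftR suc ⌝ ,ₛ π₁ (π₂ (var (suc zero)))) r₁)
                                     (sub (⌜ liftR suc ⌝ ,ₛ π₂ (π₂ (var (suc zero)))) r₂))
                    ≈ case (glue (embL P) (embR P) ls rs) (glue (embL (right P)) (embR (right P)) l₁ r₁)
                                                          (glue (embL (right P)) (embR (right P)) l₂ r₂)
  glue-case-right {Γs = Γs} {Γt} P {A} {C} {Ms} {M₁} {M₂} ls rs l₁ l₂ r₁ r₂ =
    ≈trans (≡⇒≈ (glue-as-sub l (case (rs ∘π₁) (sub (⌜ liftR suc ⌝ ,ₛ e₁) r₁) (sub (⌜ liftR suc ⌝ ,ₛ e₂) r₂))))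
      (case-cong (∘π₁-glue ls (pair l₁ l₂) rs)
                 (glue-under-right P l l₁ e₁ r₁ (≈trans (π₁-cong (×-β₂ _ _)) (×-β₁ _ _)))
                 (glue-under-right P l l₂ e₂ r₂ (≈trans (π₂-cong (×-β₂ _ _)) (×-β₂ _ _))))
    where
    l : Tm Γs (Ms `× M₁ `× M₂)
    l = pair ls (pair l₁ l₂)

    e₁ : Tm (Γt ▷ (Ms `× M₁ `× M₂) ▷ A) M₁
    e₁ = π₁ (π₂ (var (suc zero)))

    e₂ : Tm (Γt ▷ (Ms `× M₁ `× M₂) ▷ C) M₂
    e₂ = π₂ (π₂ (var (suc zero)))

  glue-case-left : ∀ {Γ Γs Γt : Ctx B} (P : Part Γ Γs Γt) {A C Ms M₁ M₂ T}
                   (ls : Tm Γt Ms) (rs : Tm (Γs ▷ Ms) (A `+ C))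
                   (l₁ : Tm (Γs ▷ A) M₁) (l₂ : Tm (Γs ▷ C) M₂) (r₁ : Tm (Γt ▷ M₁) T) (r₂ : Tm (Γt ▷ M₂) T)
                 → glue (embL P) (embR P) (lam (case rs (inl (ren (liftR suc) l₁)) (inr (ren (liftR suc) l₂))))
                                          (case (app (var zero) (wk ls)) (ren (liftR suc) r₁) (ren (liftR suc) r₂))
                   ≈ case (glue (embR P) (embL P) ls rs) (glue (embL (left P)) (embR (left P)) l₁ r₁)
                                                         (glue (embL (left P)) (embR (left P)) l₂ r₂)
  glue-case-left {Γ} {Γs} {Γt} P {Ms = Ms} {M₁} {M₂} {T} ls rs l₁ l₂ r₁ r₂ =
    ≈trans (≡⇒≈ (glue-as-sub L R))
      (≈trans (case-cong scrutinee ≈refl ≈refl)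
        (≈trans (case-commute _ _ _ _ _) (≡⇒≈ (case-≡ refl (branch l₁ r₁) (branch l₂ r₂)))))
    where
    K : Tm (Γs ▷ Ms) (M₁ `+ M₂)
    K = case rs (inl (ren (liftR suc) l₁)) (inr (ren (liftR suc) l₂))

    L : Tm Γs (Ms `→ M₁ `+ M₂)
    L = lam K

    R : Tm (Γt ▷ (Ms `→ M₁ `+ M₂)) T
    R = case (app (var zero) (wk ls)) (ren (liftR suc) r₁) (ren (liftR suc) r₂)

    γ : Sub (Γt ▷ (Ms `→ M₁ `+ M₂)) Γ
    γ = ⌜ embR P ⌝ ,ₛ ren (embL P) L

    lift-left : ∀ {X Y} (l : Tm (Γs ▷ X) Y)
              → sub (liftS (⌜ embL P ⌝ ,ₛ ren (embR P) ls)) (ren (liftR suc) l) ≡ ren (embL (left P)) l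
    lift-left l = trans (sub-ren {σ' = ⌜ embL (left P) ⌝} (λ { zero → refl ; (suc x) → refl }) l)
                        (sym (ren-as-sub (λ { zero → refl ; (suc x) → refl }) l))

    scrutinee : app (ren (embL P) L) (sub γ (wk ls))
                ≈ case (glue (embR P) (embL P) ls rs)
                       (inl (ren (embL (left P)) l₁)) (inr (ren (embL (left P)) l₂))
    scrutinee =
      ≈trans (≡⇒≈ (cong (app _) (sub-wk-ren ls)))
        (≈trans (→-β _ _)
          (≡⇒≈ (trans (glue-as-sub ls K)
                      (case-≡ (sym (glue-as-sub ls rs)) (cong inl (lift-left l₁)) (cong inr (lift-left l₂))))))

    branch : ∀ {X Y} (l : Tm (Γs ▷ X) Y) (r : Tm (Γt ▷ Y) T)
           → sub (⌜ suc ⌝ ,ₛ ren (embL (left P)) l) (sub (liftS γ) (ren (liftR suc) r))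
             ≡ glue (embL (left P)) (embR (left P)) l r
    branch l r = trans (cong (sub _) (sub-ren (λ _ → refl) r))
                       (trans (sub-sub (λ { zero → refl ; (suc x) → refl }) r) (sym (glue-as-sub l r)))

  Within : (Pol → B → Set) → Ty B → Set
  Within F A = ∀ p → occ p A ⊆ F p

  within-⊤ : ∀ {F} → Within F `⊤
  within-⊤ + b ()
  within-⊤ - b ()

  within-⊥ : ∀ {F} → Within F `⊥
  within-⊥ + b ()
  within-⊥ - b ()

  within-× : ∀ {F A C} → Within F A → Within F C → Within F (A `× C)
  within-× hA hC + b = ⊎.[ hA + b , hC + b ]
  within-× hA hC - b = ⊎.[ hA - b , hC - b ]

  within-+ : ∀ {F A C} → Within F A → Within F C → Within F (A `+ C)
  within-+ hA hC + b = ⊎.[ hA + b , hC + b ]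
  within-+ hA hC - b = ⊎.[ hA - b , hC - b ]

  within-→ : ∀ {F A C} → Within (λ p → F (flip p)) A → Within F C → Within F (A `→ C)
  within-→ hA hC + b = ⊎.[ hA - b , hC + b ]
  within-→ hA hC - b = ⊎.[ hA + b , hC - b ]

  within-dom : ∀ {F A C} → Within F (A `→ C) → Within (λ p → F (flip p)) A
  within-dom h + b m = h - b (inj₁ m)
  within-dom h - b m = h + b (inj₁ m)

  within-mono : ∀ {F G A} → (∀ p → F p ⊆ G p) → Within F A → Within G A
  within-mono F⊆G h p b = F⊆G p b ∘ h p b

  within-⊆ : ∀ {F A C} → (∀ p → occ p A ⊆ occ p C) → Within F C → Within F A
  within-⊆ A⊆C h p b = h p b ∘ A⊆C p b

  occ-×ˡ : ∀ {A C : Ty B} p → occ p A ⊆ occ p (A `× C)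
  occ-×ˡ + b = inj₁
  occ-×ˡ - b = inj₁

  occ-×ʳ : ∀ {A C : Ty B} p → occ p C ⊆ occ p (A `× C)
  occ-×ʳ + b = inj₂
  occ-×ʳ - b = inj₂

  occ-+ˡ : ∀ {A C : Ty B} p → occ p A ⊆ occ p (A `+ C)
  occ-+ˡ + b = inj₁
  occ-+ˡ - b = inj₁

  occ-+ʳ : ∀ {A C : Ty B} p → occ p C ⊆ occ p (A `+ C)
  occ-+ʳ + b = inj₂
  occ-+ʳ - b = inj₂

  occ-→-dom : ∀ {A C : Ty B} p → occ (flip p) A ⊆ occ p (A `→ C)
  occ-→-dom + b = inj₁
  occ-→-dom - b = inj₁

  occ-→-cod : ∀ {A C : Ty B} p → occ p C ⊆ occ p (A `→ C)
  occ-→-cod + b = inj₂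
  occ-→-cod - b = inj₂

  occC-flip² : ∀ {Γ : Ctx B} p → occC p Γ ⊆ occC (flip (flip p)) Γ
  occC-flip² + b = id
  occC-flip² - b = id

  occC-absorb : ∀ {Γ X} → Within (λ p → occC p Γ) X → ∀ p → occC p (Γ ▷ X) ⊆ occC p Γ
  occC-absorb hX p b = ⊎.[ id , hX p b ]

  ∋-within : ∀ {Γ A} → Γ ∋ A → Within (λ p → occC p Γ) A
  ∋-within zero p b = inj₂
  ∋-within (suc x) p b = inj₁ ∘ ∋-within x p b

  Interpolant : ∀ {Γ Δl Δr : Ctx B} {T} → Ren Δl Γ → Ren Δr Γ → (Pol → B → Set) → Tm Γ T → Set
  Interpolant {Δl = Δl} {Δr} {T} ρl ρr F t =
    Σ (Ty B) λ M → Σ (Tm Δl M) λ l → Σ (Tm (Δr ▷ M) T) λ r → (glue ρl ρr l r ≈ t) × Within F M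

  NfInterpolant : ∀ {Γ Γs Γt : Ctx B} → Part Γ Γs Γt → ∀ {T} → Tm Γ T → Set
  NfInterpolant {Γs = Γs} {Γt} P {T} =
    Interpolant (embL P) (embR P) (λ p → occC p Γs ∩ (occC (flip p) Γt ∪ occ p T))

  NeInterpolant : ∀ {Γ Γs Γt : Ctx B} → Part Γ Γs Γt → ∀ {T} → Tm Γ T → Set
  NeInterpolant {Γs = Γs} {Γt} P {T} t =
    (Within (λ p → occC p Γs) T × Interpolant (embR P) (embL P) (λ p → occC (flip p) Γs ∩ occC p Γt) t)
    ⊎ (Within (λ p → occC p Γt) T × Interpolant (embL P) (embR P) (λ p → occC p Γs ∩ occC (flip p) Γt) t)

  mutual
    nf-interpolant : ∀ {Γ Γs Γt : Ctx B} (P : Part Γ Γs Γt) {T} (t : Tm Γ T) → Nf t → NfInterpolant P t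
    nf-interpolant P star nf-star = `⊤ , star , star , ≈refl , within-⊤
    nf-interpolant P (pair t u) (nf-pair nt nu)
      with nf-interpolant P t nt | nf-interpolant P u nu
    ... | M₁ , l₁ , r₁ , e₁ , v₁ | M₂ , l₂ , r₂ , e₂ , v₂ =
      M₁ `× M₂ , pair l₁ l₂ , pair (r₁ ∘π₁) (r₂ ∘π₂) , glue-pair l₁ l₂ r₁ r₂ e₁ e₂ ,
      within-× (within-mono (λ p b → ×.map₂ (⊎.map₂ (occ-×ˡ p b))) v₁)
               (within-mono (λ p b → ×.map₂ (⊎.map₂ (occ-×ʳ p b))) v₂)
    nf-interpolant P (lam t) (nf-lam nt) with nf-interpolant (right P) t nt
    ... | M , l , r , e , v =
      M , l , lam (sub (⌜ liftR suc ⌝ ,ₛ var (suc zero)) r) , ≈trans (glue-lam P l r) (lam-cong e) ,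
      within-mono (λ p b → ×.map₂ ⊎.[ ⊎.map₂ (occ-→-dom p b) , inj₂ ∘ occ-→-cod p b ]) v
    nf-interpolant P (inl a) (nf-inl na) with nf-interpolant P a na
    ... | M , l , r , e , v = M , l , inl r , inl-cong e , within-mono (λ p b → ×.map₂ (⊎.map₂ (occ-+ˡ p b))) v
    nf-interpolant P (inr c) (nf-inr nc) with nf-interpolant P c nc
    ... | M , l , r , e , v = M , l , inr r , inr-cong e , within-mono (λ p b → ×.map₂ (⊎.map₂ (occ-+ʳ p b))) v
    nf-interpolant P t (nf-ne nt) with ne-interpolant P t nt
    ... | inj₁ (vT , M , l , r , e , v) =
      M `→ _ , lam r , app (var zero) (wk l) , ≈trans (glue-transpose l r) e ,
      within-→ (within-mono (λ p b → ×.map₂ (inj₁ ∘ occC-flip² p b)) v) (λ p b m → vT p b m , inj₂ m)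
    ... | inj₂ (_ , M , l , r , e , v) = M , l , r , e , within-mono (λ p b → ×.map₂ inj₁) v
    nf-interpolant P (raise t) (nf-raise nt) with ne-interpolant P t nt
    ... | inj₁ (_ , M , l , r , e , v) =
      M `→ `⊥ , lam r , raise (app (var zero) (wk l)) , raise-cong (≈trans (glue-transpose l r) e) ,
      within-→ (within-mono (λ p b → ×.map₂ (inj₁ ∘ occC-flip² p b)) v) within-⊥
    ... | inj₂ (_ , M , l , r , e , v) = M , l , raise r , raise-cong e , within-mono (λ p b → ×.map₂ inj₁) v
    nf-interpolant P (case s bₗ bᵣ) (nf-case ns nl nr) with ne-interpolant P s ns
    ... | inj₁ (vS , Ms , ls , rs , es , vs)
        with nf-interpolant (left P) bₗ nl | nf-interpolant (left P) bᵣ nr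
    ...   | M₁ , l₁ , r₁ , e₁ , v₁ | M₂ , l₂ , r₂ , e₂ , v₂ =
      Ms `→ M₁ `+ M₂ , lam (case rs (inl (ren (liftR suc) l₁)) (inr (ren (liftR suc) l₂))) ,
      case (app (var zero) (wk ls)) (ren (liftR suc) r₁) (ren (liftR suc) r₂) ,
      ≈trans (glue-case-left P ls rs l₁ l₂ r₁ r₂) (case-cong es e₁ e₂) ,
      within-→ (within-mono (λ p b → ×.map₂ (inj₁ ∘ occC-flip² p b)) vs)
               (within-+ (within-mono (λ p b → ×.map₁ (occC-absorb (within-⊆ occ-+ˡ vS) p b)) v₁)
                         (within-mono (λ p b → ×.map₁ (occC-absorb (within-⊆ occ-+ʳ vS) p b)) v₂))
    nf-interpolant P (case s bₗ bᵣ) (nf-case ns nl nr) | inj₂ (vS , Ms , ls , rs , es , vs)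
        with nf-interpolant (right P) bₗ nl | nf-interpolant (right P) bᵣ nr
    ...   | M₁ , l₁ , r₁ , e₁ , v₁ | M₂ , l₂ , r₂ , e₂ , v₂ =
      Ms `× M₁ `× M₂ , pair ls (pair l₁ l₂) ,
      case (rs ∘π₁) (sub (⌜ liftR suc ⌝ ,ₛ π₁ (π₂ (var (suc zero)))) r₁)
                    (sub (⌜ liftR suc ⌝ ,ₛ π₂ (π₂ (var (suc zero)))) r₂) ,
      ≈trans (glue-case-right P ls rs l₁ l₂ r₁ r₂) (case-cong es e₁ e₂) ,
      within-× (within-mono (λ p b → ×.map₂ inj₁) vs)
               (within-× (within-mono (λ p b → ×.map₂ (⊎.map₁ (occC-absorb (within-⊆ occ-+ˡ vS) (flip p) b))) v₁)
                         (within-mono (λ p b → ×.map₂ (⊎.map₁ (occC-absorb (within-⊆ occ-+ʳ vS) (flip p) b))) v₂))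

    ne-interpolant : ∀ {Γ Γs Γt : Ctx B} (P : Part Γ Γs Γt) {T} (t : Tm Γ T) → Ne t → NeInterpolant P t
    ne-interpolant P (var x) (ne-var .x) with embL-or-embR P x
    ... | inj₁ (y , refl) = inj₁ (∋-within y , `⊤ , star , var (suc y) , ≈refl , within-⊤)
    ... | inj₂ (y , refl) = inj₂ (∋-within y , `⊤ , star , var (suc y) , ≈refl , within-⊤)
    ne-interpolant P (π₁ t) (ne-π₁ nt) with ne-interpolant P t nt
    ... | inj₁ (vT , M , l , r , e , v) = inj₁ (within-⊆ occ-×ˡ vT , M , l , π₁ r , π₁-cong e , v)
    ... | inj₂ (vT , M , l , r , e , v) = inj₂ (within-⊆ occ-×ˡ vT , M , l , π₁ r , π₁-cong e , v)
    ne-interpolant P (π₂ t) (ne-π₂ nt) with ne-interpolant P t nt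
    ... | inj₁ (vT , M , l , r , e , v) = inj₁ (within-⊆ occ-×ʳ vT , M , l , π₂ r , π₂-cong e , v)
    ... | inj₂ (vT , M , l , r , e , v) = inj₂ (within-⊆ occ-×ʳ vT , M , l , π₂ r , π₂-cong e , v)
    ne-interpolant P (app t u) (ne-app nt nu) with ne-interpolant P t nt
    ... | inj₁ (vT , Mt , lt , rt , et , vt) with nf-interpolant (swap P) u nu
    ...   | Mu , lu , ru , eu , vu =
      inj₁ (within-⊆ occ-→-cod vT , Mt `× Mu , pair lt lu , app (rt ∘π₁) (ru ∘π₂) ,
            glue-app lt lu rt ru et (≈trans (≡⇒≈ (sym (glue-swap P lu ru))) eu) ,
            within-× vt (within-mono (λ p b → ×.swap ∘ ×.map₂ ⊎.[ id , within-dom vT p b ]) vu))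
    ne-interpolant P (app t u) (ne-app nt nu) | inj₂ (vT , Mt , lt , rt , et , vt) with nf-interpolant P u nu
    ...   | Mu , lu , ru , eu , vu =
      inj₂ (within-⊆ occ-→-cod vT , Mt `× Mu , pair lt lu , app (rt ∘π₁) (ru ∘π₂) , glue-app lt lu rt ru et eu ,
            within-× vt (within-mono (λ p b → ×.map₂ ⊎.[ id , within-dom vT p b ]) vu))

mainTheorem2 : {B : Set} {Γ Γs Γt : Ctx B} (P : Part Γ Γs Γt) →
    (∀ {T} (t : Tm Γ T) → Nf t →
      Σ (Ty B) λ M → Σ (Tm Γs M) λ l → Σ (Tm (Γt ▷ M) T) λ r →
        (glue (embL P) (embR P) l r ≈ t) ×
        (∀ p → occ p M ⊆ (occC p Γs ∩ (occC (flip p) Γt ∪ occ p T))))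
    ×
    (∀ {T} (t : Tm Γ T) → Ne t →
      ((∀ p → occ p T ⊆ occC p Γs) ×
        (Σ (Ty B) λ M → Σ (Tm Γt M) λ l → Σ (Tm (Γs ▷ M) T) λ r →
          (glue (embR P) (embL P) l r ≈ t) ×
          (∀ p → occ p M ⊆ (occC (flip p) Γs ∩ occC p Γt))))
      ⊎
      ((∀ p → occ p T ⊆ occC p Γt) ×
        (Σ (Ty B) λ M → Σ (Tm Γs M) λ l → Σ (Tm (Γt ▷ M) T) λ r →
          (glue (embL P) (embR P) l r ≈ t) ×
          (∀ p → occ p M ⊆ (occC p Γs ∩ occC (flip p) Γt)))))
mainTheorem2 P = nf-interpolant P , ne-interpolant P
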